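{- Let $k \ge 2$ be an integer and let $G$ be a finite $k$-regular, $k$-connected bipartite graph. If $G$ contains $\lfloor k/2 \rfloor$ completely independent spanning trees, then \[ \left\lceil \frac{\frac{|V(G)|}{2} - 1}{\lceil k/2 \rceil} \right\rceil \le \left\lfloor \frac{\frac{|V(G)|}{2}}{\lfloor k/2 \rfloor} \right\rfloor . \]
   Context: For a tree $T$ and vertices $u,v$ of $T$, let $P_T(u,v)$ denote the set of vertices on the unique $u$–$v$ path in $T$. Spanning trees $T_1,\dots,T_m$ of a graph $G$ are called completely independent spanning trees (CISTs) if they are pairwise edge-disjoint and, for every pair of distinct trees $T_i,T_j$ and every pair of vertices $u,v\in V(G)$, $P_{T_i}(u,v)\cap P_{T_j}(u,v)=\{u,v\}$ (the $u$–$v$ paths in different trees share no vertices other than $u,v$ and no edges). A $k$-regular bipartite graph with $k>0$ has partite sets of equal size $|V(G)|/2$. -}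

module Defs where

open import Data.Nat using (ℕ; zero; suc; _+_; _∸_; _≤_; _<_; ⌊_/2⌋; ⌈_/2⌉)
open import Data.Nat.DivMod using (_/_)
open import Data.Bool using (Bool; true; false; T)
open import Data.Fin using (Fin)
open import Data.Fin.Subset using (Subset; _∉_; _∈_; ∣_∣)
open import Data.List using (List; []; _∷_; length; filter)
open import Data.List.Relation.Unary.All using (All)
open import Data.List.Relation.Unary.Unique.Propositional using (Unique)
open import Data.List.Membership.Propositional using () renaming (_∈_ to _∈ₗ_)
open import Data.Fin.Properties using (_≟_)
open import Data.List using (allFin)
open import Data.Product using (Σ; _×_; ∃)
open import Relation.Binary.PropositionalEquality using (_≡_)
open import Relation.Nullary using (¬_)
open import Data.Sum using (_⊎_)

EdgeSet : ℕ → Set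
EdgeSet n = Fin n → Fin n → Bool

record Graph (n : ℕ) : Set where
  field
    adj   : EdgeSet n
    sym   : ∀ u v → adj u v ≡ adj v u
    irrefl : ∀ v → adj v v ≡ false
open Graph public

module _ {n : ℕ} where

  data Walk (E : EdgeSet n) : Fin n → Fin n → Set where
    nil  : ∀ u → Walk E u u
    cons : ∀ {u w v} → T (E u w) → Walk E w v → Walk E u v

  verts : ∀ {E u v} → Walk E u v → List (Fin n)
  verts (nil u) = u ∷ []
  verts {u = u} (cons _ p) = u ∷ verts p

  len : ∀ {E u v} → Walk E u v → ℕ
  len (nil u) = 0
  len (cons _ p) = suc (len p)

  IsPath : ∀ {E u v} → Walk E u v → Set
  IsPath p = Unique (verts p)

  degree : Graph n → Fin n → ℕ
  degree G v = length (filter (λ w → T? (adj G v w)) (allFin n))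
    where
    open import Relation.Nullary.Decidable using (Dec; yes; no)
    T? : (b : Bool) → Dec (T b)
    T? true = yes _
    T? false = no (λ ())

  Regular : ℕ → Graph n → Set
  Regular k G = ∀ v → degree G v ≡ k

  Bipartite : Graph n → Set
  Bipartite G = Σ (Fin n → Bool) λ c → ∀ u v → T (adj G u v) → ¬ (c u ≡ c v)

  ConnectedAvoiding : Graph n → Subset n → Set
  ConnectedAvoiding G S =
    ∀ u v → u ∉ S → v ∉ S → Σ (Walk (adj G) u v) λ p → All (λ w → w ∉ S) (verts p)

  Connected : EdgeSet n → Set
  Connected E = ∀ u v → Walk E u v

  KConnected : ℕ → Graph n → Set
  KConnected k G = k < n × (∀ (S : Subset n) → ∣ S ∣ < k → ConnectedAvoiding G S)

  HasCycle : EdgeSet n → Set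
  HasCycle E = Σ (Fin n) λ u → Σ (Fin n) λ v → Σ (Walk E u v) λ p →
                 IsPath p × 2 ≤ len p × T (E v u)

  record SpanningTree (G : Graph n) : Set where
    field
      edges   : EdgeSet n
      t-sym   : ∀ u v → edges u v ≡ edges v u
      t-sub   : ∀ u v → T (edges u v) → T (adj G u v)
      t-conn  : Connected edges
      t-acyc  : ¬ HasCycle edges
  open SpanningTree public

  EdgeDisjoint : EdgeSet n → EdgeSet n → Set
  EdgeDisjoint E F = ∀ u v → ¬ (T (E u v) × T (F u v))

  -- the u–v paths in E and F share only the vertices u and v
  -- (in a tree the u–v path is unique, so quantifying over all paths is the same)
  InternallyDisjointPaths : EdgeSet n → EdgeSet n → Set
  InternallyDisjointPaths E F = ∀ u v (p : Walk E u v) (q : Walk F u v) →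
    IsPath p → IsPath q → ∀ w → w ∈ₗ verts p → w ∈ₗ verts q → w ≡ u ⊎ w ≡ v

  CISTs : (G : Graph n) (m : ℕ) → (Fin m → SpanningTree G) → Set
  CISTs G m τ = ∀ i j → ¬ (i ≡ j) →
    EdgeDisjoint (edges (τ i)) (edges (τ j)) ×
    InternallyDisjointPaths (edges (τ i)) (edges (τ j))

-- floor and ceiling of a / b for b ≥ 1 (value at b = 0 is an irrelevant 0)
floorDiv : ℕ → ℕ → ℕ
floorDiv a zero = 0
floorDiv a (suc b) = a / suc b

ceilDiv : ℕ → ℕ → ℕ
ceilDiv a zero = 0
ceilDiv a (suc b) = (a + b) / suc b

-- Let m = ⌊k/2⌋, a = ⌈k/2⌉, N = ⌊n/2⌋, and let X be the smaller colour class: a vertex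
-- cover with |X| ≤ N. At every vertex each of the m trees has degree at least 1 and, the
-- trees being edge-disjoint, the degrees add up to at most k, so each tree degree is at most
-- a + 1. By Hasunuma's lemma a vertex has degree at least 2 in at most one of the trees.
-- Since X covers the n - 1 edges of the tree T_i, n - 1 ≤ |X| + a·x_i, where x_i counts the
-- vertices of X of degree at least 2 in T_i; hence x_i ≥ ⌈(N - 1)/a⌉ for every i, whereas
-- ∑ x_i ≤ |X| ≤ N.

module Submission where

open import Defs
open import Data.Nat using (ℕ; zero; suc; _+_; _*_; _∸_; _≤_; _<_; _≤ᵇ_; z≤n; s≤s; ⌊_/2⌋; ⌈_/2⌉)
open import Data.Nat.DivMod using (_/_; m<n*o⇒m/o<n; /-monoˡ-≤; m*n/n≡m)
open import Data.Nat.Properties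
  using ( +-*-semiring; +-assoc; +-comm; +-suc; *-comm; *-identityʳ
        ; ≤-refl; ≤-reflexive; ≤-trans; ≤-total; ≤-pred; <⇒≤; ≤ᵇ⇒≤; n<1+n; m≤m+n; m≤n+m
        ; +-mono-≤; +-monoˡ-≤; +-monoʳ-≤; +-monoʳ-<; +-mono-<-≤; +-mono-≤-<; +-cancelˡ-≤; +-cancelʳ-≤
        ; ∸-monoˡ-≤; m+n∸n≡m; ⌊n/2⌋-mono; ⌊n/2⌋≤⌈n/2⌉; ⌊n/2⌋+⌈n/2⌉≡n; n≡⌊n+n/2⌋
        ; module ≤-Reasoning)
open import Algebra.Properties.Semiring.Sum +-*-semiring
  using (sum; sum-cong-≗; sum-replicate-zero; sum-remove; ∑-distrib-+; ∑-comm; *-distribˡ-sum)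
open import Data.Bool using (Bool; true; false; T; not; _∧_; _∨_)
open import Data.Bool.Properties using (T-∧; T-∨; not-injective)
open import Data.Empty using (⊥; ⊥-elim)
open import Data.Fin using (Fin; zero; suc; punchIn)
open import Data.Fin.Properties using (_≟_; suc-injective; toℕ<n; punchInᵢ≢i)
open import Data.List using (_∷_; length; filter; tabulate)
open import Data.List.Properties using (filter-accept; filter-reject)
open import Data.List.Membership.Propositional using (_∈_)
open import Data.List.Relation.Binary.Subset.Propositional using (_⊆_)
open import Data.List.Relation.Unary.All using (All; []; _∷_)
open import Data.List.Relation.Unary.All.Properties using (¬Any⇒All¬; anti-mono)
open import Data.List.Relation.Unary.AllPairs using ([]; _∷_)
open import Data.List.Relation.Unary.Any using (here; there)
import Data.Product as Prod
open import Data.Product using (Σ-syntax; ∃; _×_; _,_; proj₁; proj₂)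
open import Data.Sum using (_⊎_; inj₁; inj₂)
open import Data.Vec.Functional using (removeAt)
open import Function using (_∘_; id)
open import Function.Bundles using (module Equivalence)
open Equivalence using (to; from)
open import Relation.Nullary using (¬_; Dec; does; yes; no)
open import Relation.Nullary.Decidable using (T?; dec-true)
open import Relation.Binary.PropositionalEquality as ≡ using (_≡_; _≢_; refl; cong; subst)

sum-mono-≤ : ∀ {n} {f g : Fin n → ℕ} → (∀ i → f i ≤ g i) → sum f ≤ sum g
sum-mono-≤ {zero}  f≤g = z≤n
sum-mono-≤ {suc n} f≤g = +-mono-≤ (f≤g zero) (sum-mono-≤ (f≤g ∘ suc))

sum-mono-< : ∀ {n} {f g : Fin n → ℕ} → (∀ i → f i ≤ g i) → ∀ j → f j < g j → sum f < sum g
sum-mono-< f≤g zero    fj<gj = +-mono-<-≤ fj<gj (sum-mono-≤ (f≤g ∘ suc))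
sum-mono-< f≤g (suc j) fj<gj = +-mono-≤-< (f≤g zero) (sum-mono-< (f≤g ∘ suc) j fj<gj)

sum-const : ∀ n c → sum {n} (λ _ → c) ≡ n * c
sum-const zero    c = refl
sum-const (suc n) c = cong (c +_) (sum-const n c)

lookup+n≤sum : ∀ {n} (f : Fin (suc n) → ℕ) → (∀ i → 1 ≤ f i) → ∀ j → f j + n ≤ sum f
lookup+n≤sum {n} f f≥1 j = begin
  f j + n                      ≡⟨ cong (f j +_) (≡.sym (≡.trans (sum-const n 1) (*-identityʳ n))) ⟩
  f j + sum {n} (λ _ → 1)      ≤⟨ +-monoʳ-≤ (f j) (sum-mono-≤ (λ i → f≥1 (punchIn j i))) ⟩
  f j + sum (removeAt f j)     ≡⟨ ≡.sym (sum-remove f) ⟩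
  sum f                        ∎
  where open ≤-Reasoning

lookup≤sum : ∀ {n} (f : Fin n → ℕ) i → f i ≤ sum f
lookup≤sum f zero    = m≤m+n _ _
lookup≤sum f (suc i) = ≤-trans (lookup≤sum (f ∘ suc) i) (m≤n+m _ _)

𝟙 : Bool → ℕ
𝟙 true  = 1
𝟙 false = 0

𝟙-mono : ∀ {a b} → (T a → T b) → 𝟙 a ≤ 𝟙 b
𝟙-mono {false}         _   = z≤n
𝟙-mono {true} {true}   _   = ≤-refl
𝟙-mono {true} {false} a⇒b = ⊥-elim (a⇒b _)

count : ∀ {n} → (Fin n → Bool) → ℕ
count P = sum (𝟙 ∘ P)

count-none : ∀ {n} (P : Fin n → Bool) → (∀ i → ¬ T (P i)) → count P ≡ 0
count-none {n} P none = ≡.trans (sum-cong-≗ 𝟙P≗0) (sum-replicate-zero n)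
  where
  𝟙P≗0 : ∀ i → 𝟙 (P i) ≡ 0
  𝟙P≗0 i with P i | none i
  ... | false | _      = refl
  ... | true  | ¬true  = ⊥-elim (¬true _)

count≤1 : ∀ {n} (P : Fin n → Bool) → (∀ {i j} → i ≢ j → T (P i) → T (P j) → ⊥) → count P ≤ 1
count≤1 {zero}  P unique = z≤n
count≤1 {suc n} P unique with P zero in P0
... | false = count≤1 (P ∘ suc) (λ i≢j → unique (i≢j ∘ suc-injective))
... | true  = ≤-reflexive (cong suc (count-none (P ∘ suc) (λ i → unique (λ ()) (subst T (≡.sym P0) _))))

1≤count⇒∃ : ∀ {n} (P : Fin n → Bool) → 1 ≤ count P → ∃ (T ∘ P)
1≤count⇒∃ {suc n} P 1≤c with P zero in P0
... | true  = zero , subst T (≡.sym P0) _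
... | false = let i , Pi = 1≤count⇒∃ (P ∘ suc) 1≤c in suc i , Pi

2≤count⇒∃₂ : ∀ {n} (P : Fin n → Bool) → 2 ≤ count P → Σ[ i ∈ Fin n ] Σ[ j ∈ Fin n ] i ≢ j × T (P i) × T (P j)
2≤count⇒∃₂ {suc n} P 2≤c with P zero in P0
2≤count⇒∃₂ {suc n} P (s≤s 1≤c) | true =
  let j , Pj = 1≤count⇒∃ (P ∘ suc) 1≤c in zero , suc j , (λ ()) , subst T (≡.sym P0) _ , Pj
... | false =
  let i , j , i≢j , Pi , Pj = 2≤count⇒∃₂ (P ∘ suc) 2≤c in suc i , suc j , i≢j ∘ suc-injective , Pi , Pj

count<n⇒∃¬ : ∀ {n} (P : Fin n → Bool) → count P < n → ∃ λ i → ¬ T (P i)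
count<n⇒∃¬ {suc n} P c<n with P zero in P0
... | false = zero , subst (¬_ ∘ T) (≡.sym P0) (λ ())
count<n⇒∃¬ {suc n} P (s≤s c<n) | true = let i , ¬Pi = count<n⇒∃¬ (P ∘ suc) c<n in suc i , ¬Pi

count+count-not : ∀ {n} (P : Fin n → Bool) → count P + count (not ∘ P) ≡ n
count+count-not {n} P = begin
  count P + count (not ∘ P)          ≡⟨ ≡.sym (∑-distrib-+ (𝟙 ∘ P) (𝟙 ∘ not ∘ P)) ⟩
  sum (λ i → 𝟙 (P i) + 𝟙 (not (P i))) ≡⟨ sum-cong-≗ (λ i → 𝟙+𝟙-not (P i)) ⟩
  sum {n} (λ _ → 1)                    ≡⟨ sum-const n 1 ⟩
  n * 1                                ≡⟨ *-identityʳ n ⟩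
  n                                    ∎
  where
  open ≡.≡-Reasoning
  𝟙+𝟙-not : ∀ b → 𝟙 b + 𝟙 (not b) ≡ 1
  𝟙+𝟙-not true  = refl
  𝟙+𝟙-not false = refl

insert : ∀ {n} → Fin n → (Fin n → Bool) → Fin n → Bool
insert w S v = does (v ≟ w) ∨ S v

count-insert : ∀ {n} (S : Fin n → Bool) w → ¬ T (S w) → count (insert w S) ≡ suc (count S)
count-insert S zero    w∉S with S zero
... | false = refl
... | true  = ⊥-elim (w∉S _)
count-insert S (suc w) w∉S = ≡.trans (cong (𝟙 (S zero) +_) (count-insert (S ∘ suc) w w∉S)) (+-suc _ _)

Avoiding : ∀ {n} → EdgeSet n → Fin n → Fin n → Fin n → Set
Avoiding E x a b = Σ[ p ∈ Walk E a b ] All (x ≢_) (verts p)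

module _ {n} {E : EdgeSet n} where

  open import Data.List.Membership.DecPropositional (_≟_ {n}) using (_∈?_)

  _++ʷ_ : ∀ {a b c} → Walk E a b → Walk E b c → Walk E a c
  nil _    ++ʷ q = q
  cons e p ++ʷ q = cons e (p ++ʷ q)

  All-++ʷ : ∀ {P : Fin n → Set} {a b c} (p : Walk E a b) (q : Walk E b c) →
            All P (verts p) → All P (verts q) → All P (verts (p ++ʷ q))
  All-++ʷ (nil _)    q _           Pq = Pq
  All-++ʷ (cons e p) q (Pa ∷ Pp) Pq = Pa ∷ All-++ʷ p q Pp Pq

  All-start : ∀ {P : Fin n → Set} {a b} (p : Walk E a b) → All P (verts p) → P a
  All-start (nil _)    (Pa ∷ _) = Pa
  All-start (cons _ _) (Pa ∷ _) = Pa

  reverse : (∀ u v → E u v ≡ E v u) → ∀ {a b} → Walk E a b → Walk E b a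
  reverse E-sym (nil a)            = nil a
  reverse E-sym {a} (cons {w = w} e p) = reverse E-sym p ++ʷ cons (subst T (E-sym a w) e) (nil a)

  All-reverse : ∀ {P : Fin n → Set} (E-sym : ∀ u v → E u v ≡ E v u) {a b} (p : Walk E a b) →
                All P (verts p) → All P (verts (reverse E-sym p))
  All-reverse E-sym (nil _)    Pp        = Pp
  All-reverse E-sym (cons e p) (Pa ∷ Pp) =
    All-++ʷ (reverse E-sym p) _ (All-reverse E-sym p Pp) (All-start p Pp ∷ Pa ∷ [])

  private
    dropUntil : ∀ {u w v} (q : Walk E w v) → u ∈ verts q → IsPath q →
                Σ[ r ∈ Walk E u v ] IsPath r × verts r ⊆ verts q
    dropUntil (nil _)    (here refl) q-path = nil _ , q-path , id
    dropUntil (cons e q) (here refl) q-path = cons e q , q-path , id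
    dropUntil (cons e q) (there u∈q) (_ ∷ q-path) =
      let r , r-path , r⊆q = dropUntil q u∈q q-path in r , r-path , there ∘ r⊆q

    prependToPath : ∀ {u w v} → T (E u w) → (p : Walk E w v) →
                    (Σ[ q ∈ Walk E w v ] IsPath q × verts q ⊆ verts p) →
                    Σ[ r ∈ Walk E u v ] IsPath r × verts r ⊆ u ∷ verts p
    prependToPath {u} e p (q , q-path , q⊆p) with u ∈? verts q
    ... | yes u∈q = let r , r-path , r⊆q = dropUntil q u∈q q-path in r , r-path , there ∘ q⊆p ∘ r⊆q
    ... | no  u∉q = cons e q , ¬Any⇒All¬ (verts q) u∉q ∷ q-path ,
                    λ { (here refl) → here refl ; (there w∈q) → there (q⊆p w∈q) }

  toPath : ∀ {u v} (p : Walk E u v) → Σ[ q ∈ Walk E u v ] IsPath q × verts q ⊆ verts p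
  toPath (nil u)    = nil u , [] ∷ [] , id
  toPath (cons e p) = prependToPath e p (toPath p)

  avoiding-trans : ∀ {x a b c} → Avoiding E x a b → Avoiding E x b c → Avoiding E x a c
  avoiding-trans (p , x∉p) (q , x∉q) = p ++ʷ q , All-++ʷ p q x∉p x∉q

  avoiding-sym : (∀ u v → E u v ≡ E v u) → ∀ {x a b} → Avoiding E x a b → Avoiding E x b a
  avoiding-sym E-sym (p , x∉p) = reverse E-sym p , All-reverse E-sym p x∉p

  ∈-or-avoiding : ∀ x {a b} (p : Walk E a b) → x ∈ verts p ⊎ Avoiding E x a b
  ∈-or-avoiding x p with x ∈? verts p
  ... | yes x∈p = inj₁ x∈p
  ... | no  x∉p = inj₂ (p , ¬Any⇒All¬ (verts p) x∉p)

adjacent⇒≢ : ∀ {n} (G : Graph n) {x y} → T (adj G x y) → x ≢ y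
adjacent⇒≢ G {x} xy refl = subst T (irrefl G x) xy

module _ {n} {G : Graph n} where

  tree-adjacent⇒≢ : (τ : SpanningTree G) → ∀ {x y} → T (edges τ x y) → x ≢ y
  tree-adjacent⇒≢ τ xy = adjacent⇒≢ G (t-sub τ _ _ xy)

  -- An x-avoiding y₁–y₂ path closes a cycle through the edges y₂x and xy₁.
  tree-neighbours-separated : (τ : SpanningTree G) → ∀ {x y₁ y₂} → y₁ ≢ y₂ →
    T (edges τ x y₁) → T (edges τ x y₂) → ¬ Avoiding (edges τ) x y₁ y₂
  tree-neighbours-separated τ {x} {y₁} {y₂} y₁≢y₂ xy₁ xy₂ (p , x∉p) with toPath p
  ... | q , q-path , q⊆p =
    t-acyc τ (x , y₂ , cons xy₁ q , anti-mono q⊆p x∉p ∷ q-path , s≤s (1≤len q) ,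
              subst T (t-sym τ x y₂) xy₂)
    where
    1≤len : (q : Walk (edges τ) y₁ y₂) → 1 ≤ len q
    1≤len (nil _)    = ⊥-elim (y₁≢y₂ refl)
    1≤len (cons _ _) = s≤s z≤n

  module _ (τ₁ τ₂ : SpanningTree G)
           (independent : InternallyDisjointPaths (edges τ₁) (edges τ₂)) where

    avoiding-in-one : ∀ {x a b} → x ≢ a → x ≢ b →
                      Avoiding (edges τ₁) x a b ⊎ Avoiding (edges τ₂) x a b
    avoiding-in-one {x} {a} {b} x≢a x≢b
      with toPath (t-conn τ₁ a b) | toPath (t-conn τ₂ a b)
    ... | p , p-path , _ | q , q-path , _ with ∈-or-avoiding x p | ∈-or-avoiding x q
    ...   | inj₂ avoids₁ | _            = inj₁ avoids₁
    ...   | inj₁ _       | inj₂ avoids₂ = inj₂ avoids₂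
    ...   | inj₁ x∈p     | inj₁ x∈q     with independent a b p q p-path q-path x x∈p x∈q
    ...     | inj₁ x≡a = ⊥-elim (x≢a x≡a)
    ...     | inj₂ x≡b = ⊥-elim (x≢b x≡b)

    -- Hasunuma: by avoiding-in-one, a τ₁-neighbour y₁ of x reaches every τ₂-neighbour of x in τ₂
    -- without passing x, so two τ₂-neighbours of x would be linked around x in the tree τ₂.
    inner-in-at-most-one : ∀ x → 2 ≤ count (edges τ₁ x) → 2 ≤ count (edges τ₂ x) → ⊥
    inner-in-at-most-one x 2≤deg₁ 2≤deg₂
      with 2≤count⇒∃₂ (edges τ₁ x) 2≤deg₁ | 2≤count⇒∃₂ (edges τ₂ x) 2≤deg₂
    ... | y₁ , y₂ , y₁≢y₂ , xy₁ , xy₂ | y₃ , y₄ , y₃≢y₄ , xy₃ , xy₄ =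
      tree-neighbours-separated τ₂ y₃≢y₄ xy₃ xy₄
        (avoiding-trans (avoiding-sym (t-sym τ₂) (linked₂ xy₃)) (linked₂ xy₄))
      where
      separated₁ : ¬ Avoiding (edges τ₁) x y₁ y₂
      separated₁ = tree-neighbours-separated τ₁ y₁≢y₂ xy₁ xy₂

      x≢ : ∀ {y} → T (edges τ₁ x y) → x ≢ y
      x≢ = tree-adjacent⇒≢ τ₁

      linked₂ : ∀ {y} → T (edges τ₂ x y) → Avoiding (edges τ₂) x y₁ y
      linked₂ xy with avoiding-in-one (x≢ xy₁) (tree-adjacent⇒≢ τ₂ xy)
      ... | inj₂ y₁~y = y₁~y
      ... | inj₁ y₁~y with avoiding-in-one (x≢ xy₂) (tree-adjacent⇒≢ τ₂ xy)
      ...   | inj₁ y₂~y = ⊥-elim (separated₁ (avoiding-trans y₁~y (avoiding-sym (t-sym τ₁) y₂~y)))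
      ...   | inj₂ y₂~y with avoiding-in-one (x≢ xy₁) (x≢ xy₂)
      ...     | inj₁ y₁~y₂ = ⊥-elim (separated₁ y₁~y₂)
      ...     | inj₂ y₁~y₂ = avoiding-trans y₁~y₂ y₂~y

length-filter-tabulate : ∀ {n m} (b : Fin n → Bool) (b? : ∀ w → Dec (T (b w))) (h : Fin m → Fin n) →
                         length (filter b? (tabulate h)) ≡ count (b ∘ h)
length-filter-tabulate {m = zero}  b b? h = refl
length-filter-tabulate {m = suc m} b b? h with b (h zero) in bh₀
... | true  = ≡.trans (cong length (filter-accept b? (subst T (≡.sym bh₀) _)))
                      (cong suc (length-filter-tabulate b b? (h ∘ suc)))
... | false = ≡.trans (cong length (filter-reject b? (subst (¬_ ∘ T) (≡.sym bh₀) λ ())))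
                      (length-filter-tabulate b b? (h ∘ suc))

degree≡count : ∀ {n} (G : Graph n) v → degree G v ≡ count (adj G v)
degree≡count G v = length-filter-tabulate (adj G v) _ id

connected⇒1≤count : ∀ {n} {E : EdgeSet n} → Connected E → ∀ {u v} → u ≢ v → 1 ≤ count (E u)
connected⇒1≤count E-conn {u} {v} u≢v with E-conn u v
... | nil _            = ⊥-elim (u≢v refl)
... | cons {w = w} e _ = ≤-trans (𝟙-mono {true} (λ _ → e)) (lookup≤sum (𝟙 ∘ _) w)

∑count≤count : ∀ {n m} {F : EdgeSet n} (E : Fin m → EdgeSet n) → (∀ i u v → T (E i u v) → T (F u v)) →
               (∀ {i j} → i ≢ j → EdgeDisjoint (E i) (E j)) → ∀ u → sum (λ i → count (E i u)) ≤ count (F u)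
∑count≤count {F = F} E E⊆F disjoint u = begin
  sum (λ i → count (E i u))             ≡⟨ ∑-comm (λ i v → 𝟙 (E i u v)) ⟩
  sum (λ v → count (λ i → E i u v))     ≤⟨ sum-mono-≤ at-most-one ⟩
  count (F u)                            ∎
  where
  open ≤-Reasoning
  at-most-one : ∀ v → count (λ i → E i u v) ≤ 𝟙 (F u v)
  at-most-one v with F u v in Fuv
  ... | true  = count≤1 (λ i → E i u v) (λ i≢j Ei Ej → disjoint i≢j u v (Ei , Ej))
  ... | false = ≤-reflexive (count-none (λ i → E i u v) λ i Ei → subst T Fuv (E⊆F i u v Ei))

exit-edge : ∀ {n} {E : EdgeSet n} (S : Fin n → Bool) {a b} → Walk E a b → T (S a) → ¬ T (S b) →
            Σ[ u ∈ Fin n ] Σ[ w ∈ Fin n ] T (S u) × ¬ T (S w) × T (E u w)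
exit-edge S (nil _) a∈S b∉S = ⊥-elim (b∉S a∈S)
exit-edge S {a} (cons {w = c} e p) a∈S b∉S with T? (S c)
... | yes c∈S = exit-edge S p c∈S b∉S
... | no  c∉S = a , c , a∈S , c∉S , e

⊆-insert : ∀ {n} (S : Fin n → Bool) w v → T (S v) → T (insert w S v)
⊆-insert S w v v∈S = from T-∨ (inj₂ v∈S)

∈-insert : ∀ {n} (S : Fin n → Bool) w → T (insert w S w)
∈-insert S w = subst (λ b → T (b ∨ S w)) (≡.sym (dec-true (w ≟ w) refl)) _

𝟙-< : ∀ {a b} → ¬ T a → T b → 𝟙 a < 𝟙 b
𝟙-< {false} {true} _ _ = s≤s z≤n
𝟙-< {true}         ¬a _ = ⊥-elim (¬a _)

∧-mono : ∀ {a a′ b b′} → (T a → T a′) → (T b → T b′) → T (a ∧ b) → T (a′ ∧ b′)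
∧-mono a⇒a′ b⇒b′ = from T-∧ ∘ Prod.map a⇒a′ b⇒b′ ∘ to T-∧

-- As X covers E, every edge gives an arc (u, v) with u ∈ X; growing a vertex set along exit
-- edges, each new vertex brings a new such arc, so there are at least n - 1 of them.
module _ {n} (E : EdgeSet n) (E-sym : ∀ u v → E u v ≡ E v u) (E-conn : Connected E)
         (X : Fin n → Bool) (X-covers : ∀ u v → T (E u v) → T (X u) ⊎ T (X v)) where

  arcsFromXWithin : (Fin n → Bool) → ℕ
  arcsFromXWithin S = sum λ u → count λ v → (S u ∧ S v) ∧ (X u ∧ E u v)

  private
    _⊆ᵇ_ : (Fin n → Bool) → (Fin n → Bool) → Set
    S ⊆ᵇ S′ = ∀ v → T (S v) → T (S′ v)

    arcsFromXWithin-mono-pointwise : ∀ {S S′} → S ⊆ᵇ S′ → ∀ u v →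
      𝟙 ((S u ∧ S v) ∧ (X u ∧ E u v)) ≤ 𝟙 ((S′ u ∧ S′ v) ∧ (X u ∧ E u v))
    arcsFromXWithin-mono-pointwise S⊆S′ u v = 𝟙-mono (∧-mono (∧-mono (S⊆S′ u) (S⊆S′ v)) id)

  arcsFromXWithin-mono : ∀ {S S′} → S ⊆ᵇ S′ → arcsFromXWithin S ≤ arcsFromXWithin S′
  arcsFromXWithin-mono S⊆S′ = sum-mono-≤ λ u → sum-mono-≤ (arcsFromXWithin-mono-pointwise S⊆S′ u)

  arcsFromXWithin-mono-< : ∀ {S S′} → S ⊆ᵇ S′ → ∀ {a b} → ¬ T (S a ∧ S b) → T (S′ a) → T (S′ b) →
                           T (X a) → T (E a b) → arcsFromXWithin S < arcsFromXWithin S′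
  arcsFromXWithin-mono-< S⊆S′ {a} {b} ab∉S a∈S′ b∈S′ a∈X ab =
    sum-mono-< (λ u → sum-mono-≤ (arcsFromXWithin-mono-pointwise S⊆S′ u)) a
      (sum-mono-< (arcsFromXWithin-mono-pointwise S⊆S′ a) b
        (𝟙-< (ab∉S ∘ proj₁ ∘ to T-∧) (from T-∧ (from T-∧ (a∈S′ , b∈S′) , from T-∧ (a∈X , ab)))))

  arcsFromXWithin-insert : ∀ S {u w} → T (S u) → ¬ T (S w) → T (E u w) →
                           arcsFromXWithin S < arcsFromXWithin (insert w S)
  arcsFromXWithin-insert S {u} {w} u∈S w∉S uw with X-covers u w uw
  ... | inj₁ u∈X = arcsFromXWithin-mono-< (⊆-insert S w) (w∉S ∘ proj₂ ∘ to T-∧)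
                     (⊆-insert S w u u∈S) (∈-insert S w) u∈X uw
  ... | inj₂ w∈X = arcsFromXWithin-mono-< (⊆-insert S w) (w∉S ∘ proj₁ ∘ to T-∧)
                     (∈-insert S w) (⊆-insert S w u u∈S) w∈X (subst T (E-sym u w) uw)

  grow : ∀ r t → 1 ≤ t → t ≤ n →
         Σ[ S ∈ (Fin n → Bool) ] T (S r) × count S ≡ t × t ≤ arcsFromXWithin S + 1
  grow r (suc zero) _ _ =
    insert r ∅ , ∈-insert ∅ r ,
    ≡.trans (count-insert ∅ r (λ ())) (cong suc (count-none ∅ (λ _ ()))) , m≤n+m 1 _
    where
    ∅ : Fin n → Bool
    ∅ _ = false
  grow r (suc (suc t)) _ t+2≤n with grow r (suc t) (s≤s z≤n) (<⇒≤ t+2≤n)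
  ... | S , r∈S , |S|≡t+1 , t+1≤arcs+1 with count<n⇒∃¬ S (subst (_< n) (≡.sym |S|≡t+1) t+2≤n)
  ...   | w , w∉S with exit-edge S (E-conn r w) r∈S w∉S
  ...     | u , u′ , u∈S , u′∉S , uu′ =
    insert u′ S , ⊆-insert S u′ r r∈S ,
    ≡.trans (count-insert S u′ u′∉S) (cong suc |S|≡t+1) ,
    ≤-trans (s≤s t+1≤arcs+1) (+-monoˡ-≤ 1 (arcsFromXWithin-insert S u∈S u′∉S uu′))

  n≤arcsFromX+1 : Fin n → n ≤ sum (λ u → count λ v → X u ∧ E u v) + 1
  n≤arcsFromX+1 r with grow r n (≤-trans (s≤s z≤n) (toℕ<n r)) ≤-refl
  ... | S , _ , _ , n≤arcs+1 =
    ≤-trans n≤arcs+1 (+-monoˡ-≤ 1 (arcsFromXWithin-mono {S} {λ _ → true} (λ _ _ → _)))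

ceilDiv-≤ : ∀ {a b x} → a ≤ x * suc b → ceilDiv a (suc b) ≤ x
ceilDiv-≤ {a} {b} {x} a≤x[1+b] = ≤-pred (m<n*o⇒m/o<n (begin-strict
  a + b          <⟨ +-monoʳ-< a (n<1+n b) ⟩
  a + suc b      ≤⟨ +-monoˡ-≤ (suc b) a≤x[1+b] ⟩
  x * suc b + suc b ≡⟨ +-comm (x * suc b) (suc b) ⟩
  suc x * suc b  ∎))
  where open ≤-Reasoning

≤-floorDiv : ∀ {a b c} → c * suc b ≤ a → c ≤ floorDiv a (suc b)
≤-floorDiv {a} {b} {c} c[1+b]≤a = subst (_≤ a / suc b) (m*n/n≡m c (suc b)) (/-monoˡ-≤ (suc b) c[1+b]≤a)

≤-⌊/2⌋ : ∀ {p n} → p + p ≤ n → p ≤ ⌊ n /2⌋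
≤-⌊/2⌋ {p} p+p≤n = subst (_≤ _) (≡.sym (n≡⌊n+n/2⌋ p)) (⌊n/2⌋-mono p+p≤n)

≤1+*𝟙[2≤] : ∀ d a → d ≤ suc a → d ≤ 1 + a * 𝟙 (2 ≤ᵇ d)
≤1+*𝟙[2≤] zero          a _    = z≤n
≤1+*𝟙[2≤] (suc zero)    a _    = m≤m+n 1 _
≤1+*𝟙[2≤] (suc (suc d)) a d≤a+1 = subst (suc (suc d) ≤_) (cong suc (≡.sym (*-identityʳ a))) d≤a+1

≢⇒T⊎T : ∀ {b b′} → b ≢ b′ → T b ⊎ T b′
≢⇒T⊎T {true}          _    = inj₁ _
≢⇒T⊎T {false} {true}  _    = inj₂ _
≢⇒T⊎T {false} {false} b≢b′ = ⊥-elim (b≢b′ refl)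

bipartite⇒half-vertex-cover : ∀ {n} (G : Graph n) → Bipartite G →
  Σ[ X ∈ (Fin n → Bool) ] (∀ u v → T (adj G u v) → T (X u) ⊎ T (X v)) × count X ≤ ⌊ n /2⌋
bipartite⇒half-vertex-cover G (c , proper) with ≤-total (count c) (count (not ∘ c))
... | inj₁ c≤c̅ = c , (λ u v → ≢⇒T⊎T ∘ proper u v) ,
                 ≤-⌊/2⌋ (≤-trans (+-monoʳ-≤ (count c) c≤c̅) (≤-reflexive (count+count-not c)))
... | inj₂ c̅≤c = not ∘ c , (λ u v uv → ≢⇒T⊎T (proper u v uv ∘ not-injective)) ,
                 ≤-⌊/2⌋ (≤-trans (+-monoˡ-≤ (count (not ∘ c)) c̅≤c) (≤-reflexive (count+count-not c)))

module CISTBound {k′ n′ : ℕ} (G : Graph (suc (suc n′))) (regular : Regular (suc (suc k′)) G)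
                 (τ : Fin ⌊ suc (suc k′) /2⌋ → SpanningTree G) (cists : CISTs G _ τ) where

  n k m a N : ℕ
  n = suc (suc n′)
  k = suc (suc k′)
  m = ⌊ k /2⌋
  a = ⌈ k /2⌉
  N = ⌊ n /2⌋

  deg : Fin m → Fin n → ℕ
  deg i v = count (edges (τ i) v)

  deg≤1+a : ∀ i v → deg i v ≤ suc a
  deg≤1+a i v = +-cancelʳ-≤ (m ∸ 1) (deg i v) (suc a) (begin
    deg i v + (m ∸ 1)        ≤⟨ lookup+n≤sum (λ j → deg j v) (λ j → deg-pos j) i ⟩
    sum (λ j → deg j v)      ≤⟨ ∑count≤count (edges ∘ τ) (t-sub ∘ τ) (proj₁ ∘ cists _ _) v ⟩
    count (adj G v)          ≡⟨ ≡.trans (≡.sym (degree≡count G v)) (regular v) ⟩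
    k                        ≡⟨ ≡.sym (⌊n/2⌋+⌈n/2⌉≡n k) ⟩
    m + a                    ≡⟨ +-comm m a ⟩
    a + m                    ≡⟨ +-suc a (m ∸ 1) ⟩
    suc a + (m ∸ 1)          ∎)
    where
    open ≤-Reasoning
    deg-pos : ∀ j → 1 ≤ deg j v
    deg-pos j = connected⇒1≤count (t-conn (τ j)) (punchInᵢ≢i v zero ∘ ≡.sym)

  inner : Fin m → Fin n → Bool
  inner i v = 2 ≤ᵇ deg i v

  inner-unique : ∀ v {i j} → i ≢ j → T (inner i v) → T (inner j v) → ⊥
  inner-unique v {i} {j} i≢j i-inner j-inner =
    inner-in-at-most-one (τ i) (τ j) (proj₂ (cists i j i≢j)) v (≤ᵇ⇒≤ 2 _ i-inner) (≤ᵇ⇒≤ 2 _ j-inner)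

  module _ (X : Fin n → Bool) (X-covers : ∀ u v → T (adj G u v) → T (X u) ⊎ T (X v)) where

    X∩inner : Fin m → Fin n → Bool
    X∩inner i u = X u ∧ inner i u

    innerInX : Fin m → ℕ
    innerInX i = count (X∩inner i)

    n≤|X|+a*innerInX+1 : ∀ i → n ≤ count X + a * innerInX i + 1
    n≤|X|+a*innerInX+1 i = begin
      n                                               ≤⟨ n≤arcsFromX+1 E (t-sym (τ i)) (t-conn (τ i)) X X-covers-E zero ⟩
      sum (λ u → count λ v → X u ∧ E u v) + 1         ≤⟨ +-monoˡ-≤ 1 (sum-mono-≤ arcs≤) ⟩
      sum (λ u → 𝟙 (X u) + a * 𝟙 (X∩inner i u)) + 1   ≡⟨ cong (_+ 1) (∑-distrib-+ (𝟙 ∘ X) ((a *_) ∘ 𝟙 ∘ X∩inner i)) ⟩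
      count X + sum (λ u → a * 𝟙 (X∩inner i u)) + 1   ≡⟨ cong (λ s → count X + s + 1) (≡.sym (*-distribˡ-sum a (𝟙 ∘ X∩inner i))) ⟩
      count X + a * innerInX i + 1                    ∎
      where
      open ≤-Reasoning
      E = edges (τ i)
      X-covers-E : ∀ u v → T (E u v) → T (X u) ⊎ T (X v)
      X-covers-E u v uv = X-covers u v (t-sub (τ i) u v uv)
      arcs≤ : ∀ u → count (λ v → X u ∧ E u v) ≤ 𝟙 (X u) + a * 𝟙 (X∩inner i u)
      arcs≤ u with X u
      ... | true  = ≤1+*𝟙[2≤] (deg i u) a (deg≤1+a i u)
      ... | false = ≤-trans (≤-reflexive (count-none {n} (λ _ → false) λ _ ())) z≤n

    ∑innerInX≤|X| : sum innerInX ≤ count X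
    ∑innerInX≤|X| = begin
      sum innerInX                          ≡⟨ ∑-comm (λ i u → 𝟙 (X∩inner i u)) ⟩
      sum (λ u → count λ i → X∩inner i u)   ≤⟨ sum-mono-≤ inner-somewhere≤ ⟩
      count X                               ∎
      where
      open ≤-Reasoning
      inner-somewhere≤ : ∀ u → count (λ i → X∩inner i u) ≤ 𝟙 (X u)
      inner-somewhere≤ u with X u
      ... | true  = count≤1 (λ i → inner i u) (inner-unique u)
      ... | false = ≤-reflexive (count-none {m} (λ _ → false) λ _ ())

    module _ (|X|≤N : count X ≤ N) where

      ⌈N∸1/a⌉≤innerInX : ∀ i → ceilDiv (N ∸ 1) a ≤ innerInX i
      ⌈N∸1/a⌉≤innerInX i = ceilDiv-≤ (begin
        N ∸ 1                       ≤⟨ ∸-monoˡ-≤ 1 N≤a*innerInX+1 ⟩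
        a * innerInX i + 1 ∸ 1      ≡⟨ m+n∸n≡m (a * innerInX i) 1 ⟩
        a * innerInX i              ≡⟨ *-comm a (innerInX i) ⟩
        innerInX i * a              ∎)
        where
        open ≤-Reasoning
        N≤a*innerInX+1 : N ≤ a * innerInX i + 1
        N≤a*innerInX+1 = +-cancelˡ-≤ N N _ (begin
          N + N                       ≤⟨ +-monoʳ-≤ N (⌊n/2⌋≤⌈n/2⌉ n) ⟩
          N + ⌈ n /2⌉                 ≡⟨ ⌊n/2⌋+⌈n/2⌉≡n n ⟩
          n                           ≤⟨ n≤|X|+a*innerInX+1 i ⟩
          count X + a * innerInX i + 1 ≤⟨ +-monoˡ-≤ 1 (+-monoˡ-≤ (a * innerInX i) |X|≤N) ⟩
          N + a * innerInX i + 1      ≡⟨ +-assoc N _ 1 ⟩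
          N + (a * innerInX i + 1)    ∎)

      bound : ceilDiv (N ∸ 1) a ≤ floorDiv N m
      bound = ≤-floorDiv (begin
        ceilDiv (N ∸ 1) a * m              ≡⟨ *-comm _ m ⟩
        m * ceilDiv (N ∸ 1) a              ≡⟨ ≡.sym (sum-const m _) ⟩
        sum {m} (λ _ → ceilDiv (N ∸ 1) a)  ≤⟨ sum-mono-≤ ⌈N∸1/a⌉≤innerInX ⟩
        sum innerInX                       ≤⟨ ∑innerInX≤|X| ⟩
        count X                            ≤⟨ |X|≤N ⟩
        N                                  ∎)
        where open ≤-Reasoning

theorem3p1 : (k n : ℕ) → 2 ≤ k → (G : Graph n) →
    Regular k G → KConnected k G → Bipartite G →
    (τ : Fin ⌊ k /2⌋ → SpanningTree G) → CISTs G ⌊ k /2⌋ τ →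
    ceilDiv (⌊ n /2⌋ ∸ 1) ⌈ k /2⌉ ≤ floorDiv ⌊ n /2⌋ ⌊ k /2⌋
theorem3p1 (suc (suc k′)) (suc (suc n′)) _ G regular _ bipartite τ cists =
  let X , X-covers , |X|≤N = bipartite⇒half-vertex-cover G bipartite
  in  CISTBound.bound G regular τ cists X X-covers |X|≤N
theorem3p1 (suc (suc k′)) zero          _        _ _ (() , _)     _ _ _
theorem3p1 (suc (suc k′)) (suc zero)    _        _ _ (s≤s () , _) _ _ _
theorem3p1 zero           _             ()
theorem3p1 (suc zero)     _             (s≤s ())
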